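{- For every positive integer $k$ and every prime number $p$, $$v_p\left(F_{kp,k}\right) = -k,$$ where $$F_{kp,k} = \sum_{\substack{i_1,\dots,i_k \ge 1\\ i_1+\dots+i_k = kp}} \frac{1}{i_1 i_2\cdots i_k}$$ (the sum over $k$-tuples of positive integers).
   Context: $v_p$ denotes the $p$-adic valuation, extended to nonzero rational numbers. -}

module Defs where

open import Data.Nat as ℕ using (ℕ; zero; suc; _^_; _∸_)
open import Data.Nat.Divisibility using (_∣_)
open import Data.Integer as ℤ using (ℤ; +_; ∣_∣)
open import Data.Rational as ℚ using (ℚ; ↥_; ↧ₙ_; 0ℚ; 1ℚ)
open import Data.Product using (Σ; _×_; ∃₂)
open import Relation.Nullary using (¬_)
open import Relation.Binary.PropositionalEquality using (_≡_)

-- 1/i as a rational, for i = suc j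
recip : ℕ → ℚ
recip j = (+ 1) ℚ./ suc j

sumFrom1 : ℕ → (ℕ → ℚ) → ℚ
sumFrom1 zero    f = 0ℚ
sumFrom1 (suc m) f = sumFrom1 m f ℚ.+ f (suc m)

-- F k n = Σ over (i₁,…,i_k) with all i_j ≥ 1 and i₁+…+i_k = n of 1/(i₁⋯i_k),
-- defined by recursion on k, splitting off the first entry i₁ = i:
--   F 0 0 = 1 (empty tuple), F 0 (n+1) = 0,
--   F (k+1) n = Σ_{i=1}^{n} (1/i) · F k (n - i).
F : ℕ → ℕ → ℚ
F zero zero    = 1ℚ
F zero (suc n) = 0ℚ
F (suc k) n = sumFrom1 n (λ i → recip (i ∸ 1) ℚ.* F k (n ∸ i))

HasValℕ : ℕ → ℕ → ℕ → Set
HasValℕ p n e = (p ^ e ∣ n) × ¬ (p ^ suc e ∣ n)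

HasValℚ : ℕ → ℚ → ℤ → Set
HasValℚ p q z =
  ¬ (q ≡ 0ℚ) ×
  ∃₂ (λ a b → HasValℕ p ∣ ↥ q ∣ a × HasValℕ p (↧ₙ q) b × ((+ a) ℤ.- (+ b) ≡ z))

module Submission where

-- Write v = v_p and q = p - 1.  Since pᵉ ≥ 1 + qe, every i ≥ 1 satisfies q·v(i) ≤ i - 1,
-- with equality only for i ∈ {1, p}.  Hence a composition (i₁, …, i_k) of n has
-- q·Σ v(iⱼ) ≤ n - k, and when equality holds all parts are 1 or p, which forces n ≤ kp.
-- For n = kp the composition (p, …, p) therefore contributes p^(-k), while every other
-- term has valuation > -k, so the sum has valuation exactly -k.

open import Defs

open import Algebra.Bundles using (CommutativeMonoid; CommutativeRing)
open import Data.Empty using (⊥-elim)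
open import Data.Integer as ℤ using (+_; -_)
import Data.Integer.Properties as ℤP
import Data.Integer.Tactic.RingSolver as ℤ-Tactic
open import Data.List using (_∷_; [])
open import Data.Nat as ℕ
  using (ℕ; zero; suc; _+_; _*_; _^_; _∸_; _≤_; _<_; z≤n; s≤s; z<s; NonZero; _≟_; _≤?_)
open import Data.Nat.Coprimality using (Coprime; recompute)
open import Data.Nat.Divisibility
  using (_∣_; _∣?_; _∣0; 1∣_; ∣-trans; ∣1⇒≡1; m∣m*n; n∣m*n; ∣n⇒∣m*n; *-monoˡ-∣; *-cancelʳ-∣;
         ∣m+n∣m⇒∣n; divides; quotient; quotient≢0; quotient-<; m∣n⇒n≡quotient*m)
open import Data.Nat.Induction using (<-wellFounded)
open import Data.Nat.Primality using (Prime; euclidsLemma)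
open import Data.Nat.Properties
open import Data.Nat.Tactic.RingSolver using (solve; solve-∀)
open import Data.Product using (_×_; _,_; ∃; ∃₂; proj₁; proj₂)
open import Data.Rational as ℚ using (ℚ; mkℚ; ↥_; ↧ₙ_; 0ℚ; 1ℚ; toℚᵘ)
import Data.Rational.Properties as ℚP
open import Data.Rational.Unnormalised as ℚᵘ using (mkℚᵘ; *≡*; _≃_)
import Data.Rational.Unnormalised.Properties as ℚᵘP
open import Data.Sum using (inj₁; inj₂; [_,_])
open import Function using (_∘_; _$_)
open import Induction.WellFounded using (Acc; acc)
open import Relation.Binary.PropositionalEquality hiding ([_])
open import Relation.Nullary using (¬_; yes; no)

open import Algebra.Properties.CommutativeSemigroup
  (CommutativeMonoid.commutativeSemigroup ℚP.*-1-commutativeMonoid)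
  using () renaming (interchange to *-interchange)
open import Algebra.Properties.Semiring.Mult (CommutativeRing.semiring ℚP.+-*-commutativeRing)
  using (×-homo-+; ×1-homo-*) renaming (_×_ to _×ℚ_)

fromℕ : ℕ → ℚ
fromℕ n = n ×ℚ 1ℚ

fromℕ-+ : ∀ m n → fromℕ (m + n) ≡ fromℕ m ℚ.+ fromℕ n
fromℕ-+ = ×-homo-+ 1ℚ

fromℕ-* : ∀ m n → fromℕ (m * n) ≡ fromℕ m ℚ.* fromℕ n
fromℕ-* = ×1-homo-*

toℚᵘ-fromℕ : ∀ n → toℚᵘ (fromℕ n) ≃ mkℚᵘ (+ n) 0
toℚᵘ-fromℕ zero = ℚᵘP.≃-refl
toℚᵘ-fromℕ (suc n) = begin
  toℚᵘ (1ℚ ℚ.+ fromℕ n)            ≈⟨ ℚP.toℚᵘ-homo-+ 1ℚ (fromℕ n) ⟩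
  ℚᵘ.1ℚᵘ ℚᵘ.+ toℚᵘ (fromℕ n)        ≈⟨ ℚᵘP.+-congʳ ℚᵘ.1ℚᵘ (toℚᵘ-fromℕ n) ⟩
  ℚᵘ.1ℚᵘ ℚᵘ.+ mkℚᵘ (+ n) 0          ≈⟨ *≡* (identity (+ n)) ⟩
  mkℚᵘ (+ suc n) 0                  ∎
  where
  open ℚᵘP.≃-Reasoning
  identity : ∀ n → (+ 1 ℤ.* + 1 ℤ.+ n ℤ.* + 1) ℤ.* + 1 ≡ (+ 1 ℤ.+ n) ℤ.* + 1
  identity = ℤ-Tactic.solve-∀

recip*fromℕ : ∀ j → recip j ℚ.* fromℕ (suc j) ≡ 1ℚ
recip*fromℕ j = ℚP.toℚᵘ-injective (begin
  toℚᵘ (recip j ℚ.* fromℕ (suc j))          ≈⟨ ℚP.toℚᵘ-homo-* (recip j) (fromℕ (suc j)) ⟩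
  toℚᵘ (recip j) ℚᵘ.* toℚᵘ (fromℕ (suc j))  ≈⟨ ℚᵘP.*-cong (ℚP.toℚᵘ-fromℚᵘ (mkℚᵘ (+ 1) j)) (toℚᵘ-fromℕ (suc j)) ⟩
  mkℚᵘ (+ 1) j ℚᵘ.* mkℚᵘ (+ suc j) 0        ≈⟨ *≡* (cong (λ d → + suc d) (solve (j ∷ []))) ⟩
  toℚᵘ 1ℚ                                   ∎)
  where open ℚᵘP.≃-Reasoning

infix 4 _≐_/_

-- A record rather than a defined abbreviation, so that x, a and d can be inferred.
record _≐_/_ (x : ℚ) (a d : ℕ) : Set where
  constructor ≐-intro
  field ≐-elim : x ℚ.* fromℕ d ≡ fromℕ a

≐-+ : ∀ {x y a c d} → x ≐ a / d → y ≐ c / d → x ℚ.+ y ≐ a + c / d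
≐-+ {x} {y} {a} {c} {d} (≐-intro x≐) (≐-intro y≐) = ≐-intro $ begin
  (x ℚ.+ y) ℚ.* fromℕ d            ≡⟨ ℚP.*-distribʳ-+ (fromℕ d) x y ⟩
  x ℚ.* fromℕ d ℚ.+ y ℚ.* fromℕ d  ≡⟨ cong₂ ℚ._+_ x≐ y≐ ⟩
  fromℕ a ℚ.+ fromℕ c              ≡⟨ fromℕ-+ a c ⟨
  fromℕ (a + c)                    ∎
  where open ≡-Reasoning

≐-* : ∀ {x y a c d e} → x ≐ a / d → y ≐ c / e → x ℚ.* y ≐ a * c / d * e
≐-* {x} {y} {a} {c} {d} {e} (≐-intro x≐) (≐-intro y≐) = ≐-intro $ begin
  x ℚ.* y ℚ.* fromℕ (d * e)                 ≡⟨ cong (x ℚ.* y ℚ.*_) (fromℕ-* d e) ⟩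
  x ℚ.* y ℚ.* (fromℕ d ℚ.* fromℕ e)         ≡⟨ *-interchange x y (fromℕ d) (fromℕ e) ⟩
  x ℚ.* fromℕ d ℚ.* (y ℚ.* fromℕ e)         ≡⟨ cong₂ ℚ._*_ x≐ y≐ ⟩
  fromℕ a ℚ.* fromℕ c                       ≡⟨ fromℕ-* a c ⟨
  fromℕ (a * c)                             ∎
  where open ≡-Reasoning

≐-rescale : ∀ {x a d d′} m → d * m ≡ d′ → x ≐ a / d → x ≐ a * m / d′
≐-rescale {x} {a} {d} m refl (≐-intro x≐) = ≐-intro $ begin
  x ℚ.* fromℕ (d * m)               ≡⟨ cong (x ℚ.*_) (fromℕ-* d m) ⟩
  x ℚ.* (fromℕ d ℚ.* fromℕ m)       ≡⟨ ℚP.*-assoc x (fromℕ d) (fromℕ m) ⟨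
  x ℚ.* fromℕ d ℚ.* fromℕ m         ≡⟨ cong (ℚ._* fromℕ m) x≐ ⟩
  fromℕ a ℚ.* fromℕ m               ≡⟨ fromℕ-* a m ⟨
  fromℕ (a * m)                     ∎
  where open ≡-Reasoning

≐⇒toℚᵘ : ∀ {x a d} → x ≐ a / d → toℚᵘ x ℚᵘ.* mkℚᵘ (+ d) 0 ≃ mkℚᵘ (+ a) 0
≐⇒toℚᵘ {x} {a} {d} (≐-intro x≐) = begin
  toℚᵘ x ℚᵘ.* mkℚᵘ (+ d) 0       ≈⟨ ℚᵘP.*-congˡ {toℚᵘ x} (toℚᵘ-fromℕ d) ⟨
  toℚᵘ x ℚᵘ.* toℚᵘ (fromℕ d)     ≈⟨ ℚP.toℚᵘ-homo-* x (fromℕ d) ⟨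
  toℚᵘ (x ℚ.* fromℕ d)           ≡⟨ cong toℚᵘ x≐ ⟩
  toℚᵘ (fromℕ a)                 ≈⟨ toℚᵘ-fromℕ a ⟩
  mkℚᵘ (+ a) 0                   ∎
  where open ℚᵘP.≃-Reasoning

≐⇒∣↥∣*≡*↧ₙ : ∀ {x a d} → x ≐ a / d → ℤ.∣ ↥ x ∣ * d ≡ a * ↧ₙ x
≐⇒∣↥∣*≡*↧ₙ {x@(mkℚ n d-1 _)} {a} {d} x≐ = begin
  ℤ.∣ n ∣ * d                   ≡⟨ ℤP.abs-* n (+ d) ⟨
  ℤ.∣ n ℤ.* + d ∣               ≡⟨ *-identityʳ _ ⟨
  ℤ.∣ n ℤ.* + d ∣ * 1           ≡⟨ ℤP.abs-* (n ℤ.* + d) (+ 1) ⟨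
  ℤ.∣ n ℤ.* + d ℤ.* + 1 ∣       ≡⟨ cong ℤ.∣_∣ (ℚᵘP.drop-*≡* (≐⇒toℚᵘ x≐)) ⟩
  ℤ.∣ + a ℤ.* + suc (d-1 * 1) ∣ ≡⟨ ℤP.abs-* (+ a) _ ⟩
  a * suc (d-1 * 1)             ≡⟨ cong (λ e → a * suc e) (*-identityʳ d-1) ⟩
  a * suc d-1                   ∎
  where open ≡-Reasoning

sumFrom1-zero : ∀ m f → (∀ i → 1 ≤ i → i ≤ m → f i ≡ 0ℚ) → sumFrom1 m f ≡ 0ℚ
sumFrom1-zero zero    f f≡0 = refl
sumFrom1-zero (suc m) f f≡0 = cong₂ ℚ._+_
  (sumFrom1-zero m f (λ i 1≤i i≤m → f≡0 i 1≤i (m≤n⇒m≤1+n i≤m)))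
  (f≡0 (suc m) (s≤s z≤n) ≤-refl)

F≡0 : ∀ k n → n < k → F k n ≡ 0ℚ
F≡0 (suc k) n n<1+k = sumFrom1-zero n _ λ where
  (suc i) _ 1+i≤n →
    trans (cong (recip i ℚ.*_) (F≡0 k (n ∸ suc i) (<-≤-trans (∸-monoʳ-< z<s 1+i≤n) (≤-pred n<1+k))))
          (ℚP.*-zeroʳ (recip i))

module _ (r : ℕ) (p-prime : Prime (suc (suc r))) where

  private
    p q : ℕ
    p = suc (suc r)
    q = suc r

  p∤1 : ¬ p ∣ 1
  p∤1 p∣1 with ∣1⇒≡1 p∣1
  ... | ()

  p∤* : ∀ {a b} → ¬ p ∣ a → ¬ p ∣ b → ¬ p ∣ a * b
  p∤* {a} {b} p∤a p∤b p∣ab = [ p∤a , p∤b ] (euclidsLemma a b p-prime p∣ab)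

  -- Pole≤ e x : v(x) ≥ -e,  Pole≡ e x : v(x) = -e.  Natural numerators suffice, as F ≥ 0.
  data Pole≤ (e : ℕ) (x : ℚ) : Set where
    pole≤ : ∀ a b → ¬ p ∣ b → x ≐ a / b * p ^ e → Pole≤ e x

  data Pole≡ (e : ℕ) (x : ℚ) : Set where
    pole≡ : ∀ a b → ¬ p ∣ a → ¬ p ∣ b → x ≐ a / b * p ^ e → Pole≡ e x

  pole≤-0ℚ : ∀ {e} → Pole≤ e 0ℚ
  pole≤-0ℚ {e} = pole≤ 0 1 p∤1 $ ≐-intro (ℚP.*-zeroˡ (fromℕ (1 * p ^ e)))

  pole≤-1ℚ : ∀ {e} → Pole≤ e 1ℚ
  pole≤-1ℚ {e} = pole≤ (p ^ e) 1 p∤1 (≐-intro (trans (ℚP.*-identityˡ _) (cong fromℕ (*-identityˡ (p ^ e)))))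

  pole≡-1ℚ : Pole≡ 0 1ℚ
  pole≡-1ℚ = pole≡ 1 1 p∤1 p∤1 $ ≐-intro (ℚP.*-identityˡ (fromℕ 1))

  pole≤-+ : ∀ {e x y} → Pole≤ e x → Pole≤ e y → Pole≤ e (x ℚ.+ y)
  pole≤-+ {e} (pole≤ a₁ b₁ p∤b₁ x≐) (pole≤ a₂ b₂ p∤b₂ y≐) =
    pole≤ (a₁ * b₂ + a₂ * b₁) (b₁ * b₂) (p∤* p∤b₁ p∤b₂) $
    ≐-+ (≐-rescale b₂ (rearrange₁ b₁ (p ^ e) b₂) x≐) (≐-rescale b₁ (rearrange₂ b₂ (p ^ e) b₁) y≐)
    where
    rearrange₁ : ∀ b₁ P b₂ → b₁ * P * b₂ ≡ b₁ * b₂ * P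
    rearrange₁ = solve-∀
    rearrange₂ : ∀ b₂ P b₁ → b₂ * P * b₁ ≡ b₁ * b₂ * P
    rearrange₂ = solve-∀

  ≐-*-pow : ∀ {x y a₁ a₂} b₁ b₂ e f → x ≐ a₁ / b₁ * p ^ e → y ≐ a₂ / b₂ * p ^ f →
            x ℚ.* y ≐ a₁ * a₂ / b₁ * b₂ * p ^ (e + f)
  ≐-*-pow {x} {y} {a₁} {a₂} b₁ b₂ e f x≐ y≐ =
    subst (x ℚ.* y ≐ a₁ * a₂ /_) denominators (≐-* x≐ y≐)
    where
    interchange : ∀ a b c d → a * b * (c * d) ≡ a * c * (b * d)
    interchange = solve-∀
    denominators : b₁ * p ^ e * (b₂ * p ^ f) ≡ b₁ * b₂ * p ^ (e + f)
    denominators = trans (interchange b₁ (p ^ e) b₂ (p ^ f)) (cong (b₁ * b₂ *_) (sym (^-distribˡ-+-* p e f)))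

  pole≤-* : ∀ {e f x y} → Pole≤ e x → Pole≤ f y → Pole≤ (e + f) (x ℚ.* y)
  pole≤-* {e} {f} (pole≤ a₁ b₁ p∤b₁ x≐) (pole≤ a₂ b₂ p∤b₂ y≐) =
    pole≤ (a₁ * a₂) (b₁ * b₂) (p∤* p∤b₁ p∤b₂) $ ≐-*-pow b₁ b₂ e f x≐ y≐

  pole≡-* : ∀ {e f x y} → Pole≡ e x → Pole≡ f y → Pole≡ (e + f) (x ℚ.* y)
  pole≡-* {e} {f} (pole≡ a₁ b₁ p∤a₁ p∤b₁ x≐) (pole≡ a₂ b₂ p∤a₂ p∤b₂ y≐) =
    pole≡ (a₁ * a₂) (b₁ * b₂) (p∤* p∤a₁ p∤a₂) (p∤* p∤b₁ p∤b₂) $ ≐-*-pow b₁ b₂ e f x≐ y≐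

  pole≡+pole≤ : ∀ {e x y} → Pole≡ (suc e) x → Pole≤ e y → Pole≡ (suc e) (x ℚ.+ y)
  pole≡+pole≤ {e} (pole≡ a₁ b₁ p∤a₁ p∤b₁ x≐) (pole≤ a₂ b₂ p∤b₂ y≐) =
    pole≡ (a₁ * b₂ + a₂ * (b₁ * p)) (b₁ * b₂) p∤numerator (p∤* p∤b₁ p∤b₂) $
    ≐-+ (≐-rescale b₂ (rearrange₁ b₁ (p ^ suc e) b₂) x≐) (≐-rescale (b₁ * p) (rearrange₂ b₂ (p ^ e) b₁ p) y≐)
    where
    rearrange₁ : ∀ b₁ P b₂ → b₁ * P * b₂ ≡ b₁ * b₂ * P
    rearrange₁ = solve-∀
    rearrange₂ : ∀ b₂ P b₁ p → b₂ * P * (b₁ * p) ≡ b₁ * b₂ * (p * P)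
    rearrange₂ = solve-∀
    p∤numerator : ¬ p ∣ a₁ * b₂ + a₂ * (b₁ * p)
    p∤numerator p∣ = p∤* p∤a₁ p∤b₂
      (∣m+n∣m⇒∣n (subst (p ∣_) (+-comm (a₁ * b₂) _) p∣) (∣n⇒∣m*n a₂ (n∣m*n b₁)))

  pole≤-sumFrom1 : ∀ {e} m f → (∀ i → 1 ≤ i → i ≤ m → Pole≤ e (f i)) → Pole≤ e (sumFrom1 m f)
  pole≤-sumFrom1 zero    f _ = pole≤-0ℚ
  pole≤-sumFrom1 (suc m) f pole = pole≤-+
    (pole≤-sumFrom1 m f (λ i 1≤i i≤m → pole i 1≤i (m≤n⇒m≤1+n i≤m)))
    (pole (suc m) (s≤s z≤n) ≤-refl)

  pole≡-sumFrom1 : ∀ {e} m f j → 1 ≤ j → j ≤ m → Pole≡ (suc e) (f j) →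
                   (∀ i → 1 ≤ i → i ≤ m → i ≢ j → Pole≤ e (f i)) → Pole≡ (suc e) (sumFrom1 m f)
  pole≡-sumFrom1 zero    f (suc _) _ () _ _
  pole≡-sumFrom1 (suc m) f j 1≤j j≤1+m pole-j pole with j ≟ suc m
  ... | yes refl = subst (Pole≡ _) (ℚP.+-comm (f (suc m)) _) (pole≡+pole≤ pole-j
          (pole≤-sumFrom1 m f λ i 1≤i i≤m → pole i 1≤i (m≤n⇒m≤1+n i≤m) (<⇒≢ (s≤s i≤m))))
  ... | no j≢1+m = pole≡+pole≤
          (pole≡-sumFrom1 m f j 1≤j (≤-pred (≤∧≢⇒< j≤1+m j≢1+m)) pole-j
            λ i 1≤i i≤m → pole i 1≤i (m≤n⇒m≤1+n i≤m))
          (pole (suc m) (s≤s z≤n) ≤-refl (j≢1+m ∘ sym))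

  factorise : ∀ n .{{_ : NonZero n}} → ∃₂ λ e b → ¬ p ∣ b × n ≡ b * p ^ e
  factorise n = go n (<-wellFounded n)
    where
    go : ∀ n .{{_ : NonZero n}} → Acc _<_ n → ∃₂ λ e b → ¬ p ∣ b × n ≡ b * p ^ e
    go n (acc rec) with p ∣? n
    ... | no p∤n = 0 , n , p∤n , sym (*-identityʳ n)
    ... | yes p∣n with go (quotient p∣n) {{quotient≢0 p∣n}} (rec (quotient-< p∣n))
    ...   | e , b , p∤b , n/p≡ = suc e , b , p∤b , (begin
      n                 ≡⟨ m∣n⇒n≡quotient*m p∣n ⟩
      quotient p∣n * p  ≡⟨ cong (_* p) n/p≡ ⟩
      b * p ^ e * p     ≡⟨ rearrange b (p ^ e) p ⟩
      b * (p * p ^ e)   ∎)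
      where
      open ≡-Reasoning
      rearrange : ∀ b P p → b * P * p ≡ b * (p * P)
      rearrange = solve-∀

  p*[1+e*q] : ∀ e → 1 + suc e * q + e * q * q ≡ p * (1 + e * q)
  p*[1+e*q] e = identity r e
    where
    identity : ∀ r e → 1 + suc e * suc r + e * suc r * suc r ≡ suc (suc r) * (1 + e * suc r)
    identity = solve-∀

  1+e*q≤p^e : ∀ e → 1 + e * q ≤ p ^ e
  1+e*q≤p^e zero    = ≤-refl
  1+e*q≤p^e (suc e) = begin
    1 + suc e * q              ≤⟨ m≤m+n _ (e * q * q) ⟩
    1 + suc e * q + e * q * q  ≡⟨ p*[1+e*q] e ⟩
    p * (1 + e * q)            ≤⟨ *-monoʳ-≤ p (1+e*q≤p^e e) ⟩
    p * p ^ e                  ∎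
    where open ≤-Reasoning

  2+[2+e]*q≤p^[2+e] : ∀ e → 2 + (2 + e) * q ≤ p ^ (2 + e)
  2+[2+e]*q≤p^[2+e] e = begin
    2 + (2 + e) * q                    ≡⟨ +-comm 1 (1 + (2 + e) * q) ⟩
    1 + (2 + e) * q + 1                ≤⟨ +-monoʳ-≤ (1 + (2 + e) * q) (s≤s z≤n) ⟩
    1 + (2 + e) * q + (1 + e) * q * q  ≡⟨ p*[1+e*q] (1 + e) ⟩
    p * (1 + (1 + e) * q)              ≤⟨ *-monoʳ-≤ p (1+e*q≤p^e (1 + e)) ⟩
    p * p ^ (1 + e)                    ∎
    where open ≤-Reasoning

  2+e*q≤[1+b]*p^e : ∀ b e → p < suc b * p ^ e → 2 + e * q ≤ suc b * p ^ e
  2+e*q≤[1+b]*p^e b zero          p<i = ≤-trans (s≤s (s≤s z≤n)) p<i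
  2+e*q≤[1+b]*p^e b (suc zero)    p<i = ≤-trans (≤-reflexive (cong (λ n → 2 + n) (+-identityʳ q))) p<i
  2+e*q≤[1+b]*p^e b (suc (suc e)) _   = ≤-trans (2+[2+e]*q≤p^[2+e] e) (m≤m+n _ _)

  1+e*q+t≤[1+b]*p^e : ∀ b e → ∃ λ t → 1 + e * q + t ≤ suc b * p ^ e × (t ≡ 0 → suc b * p ^ e ≤ p)
  1+e*q+t≤[1+b]*p^e b e with suc b * p ^ e ≤? p
  ... | yes i≤p = 0 , ≤-trans (≤-reflexive (+-identityʳ _)) (≤-trans (1+e*q≤p^e e) (m≤m+n _ _)) , λ _ → i≤p
  ... | no  i≰p = 1 , ≤-trans (≤-reflexive (+-comm _ 1)) (2+e*q≤[1+b]*p^e b e (≰⇒> i≰p)) , λ ()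

  recip-pole : ∀ j → ∃₂ λ e t → Pole≤ e (recip j) × 1 + e * q + t ≤ suc j × (t ≡ 0 → suc j ≤ p)
  recip-pole j with factorise (suc j)
  ... | e , suc b , p∤b , 1+j≡ with 1+e*q+t≤[1+b]*p^e b e
  ...   | t , bound , tight =
    e , t , pole≤ 1 (suc b) p∤b (subst (recip j ≐ 1 /_) 1+j≡ (≐-intro (recip*fromℕ j))) ,
    subst (1 + e * q + t ≤_) (sym 1+j≡) bound , subst (_≤ p) (sym 1+j≡) ∘ tight

  pole≡-recip : Pole≡ 1 (recip q)
  pole≡-recip = pole≡ 1 1 p∤1 p∤1 $ ≐-intro $
    subst (λ d → recip q ℚ.* fromℕ d ≡ 1ℚ) (sym (trans (*-identityˡ (p * 1)) (*-identityʳ p))) (recip*fromℕ q)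

  -- qE ≥ n - k, with equality only if n > kp (s is the slack); so every composition of n
  -- into k parts has Σ v(iⱼ) < E.
  Room : ℕ → ℕ → ℕ → Set
  Room k n E = ∃ λ s → n + s ≤ E * q + k × (s ≡ 0 → k * p < n)

  room⇒F≡0 : ∀ {k n} → Room k n 0 → F k n ≡ 0ℚ
  room⇒F≡0 {k} {n} (zero , n+0≤k , tight) =
    ⊥-elim (<-irrefl refl (<-≤-trans (tight refl) (≤-trans (≤-trans (m≤m+n n 0) n+0≤k) (m≤m*n k p))))
  room⇒F≡0 {k} {n} (suc s , n+1+s≤k , _) = F≡0 k n (<-≤-trans (m<m+n n z<s) n+1+s≤k)

  remainder-room : ∀ {n j s} k E e t → suc j ≤ n → n + s ≤ suc E * q + suc k → 1 + e * q + t ≤ suc j →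
                   n ∸ suc j + (s + t) + e * q ≤ suc E * q + k
  remainder-room {n} {j} {s} k E e t 1+j≤n room bound = ≤-pred (begin
    1 + (n ∸ suc j + (s + t) + e * q)  ≡⟨ rearrange (n ∸ suc j) s t (e * q) ⟩
    1 + e * q + t + (n ∸ suc j) + s    ≤⟨ +-monoˡ-≤ s (+-monoˡ-≤ (n ∸ suc j) bound) ⟩
    suc j + (n ∸ suc j) + s            ≡⟨ cong (_+ s) (m+[n∸m]≡n 1+j≤n) ⟩
    n + s                              ≤⟨ room ⟩
    suc E * q + suc k                  ≡⟨ +-suc (suc E * q) k ⟩
    suc (suc E * q + k)                ∎)
    where
    open ≤-Reasoning
    rearrange : ∀ m s t x → 1 + (m + (s + t) + x) ≡ 1 + x + t + m + s
    rearrange = solve-∀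

  remainder-tight : ∀ {n j s t} k → (s ≡ 0 → suc j ≤ p → suc j + k * p < n) → (t ≡ 0 → suc j ≤ p) →
                    s + t ≡ 0 → k * p < n ∸ suc j
  remainder-tight {n} {j} {s} k tight t≡0⇒ s+t≡0 =
    m+n≤o⇒m≤o∸n (suc (k * p)) (subst (_≤ n) (cong suc (+-comm (suc j) (k * p)))
      (tight (m+n≡0⇒m≡0 s s+t≡0) (t≡0⇒ (m+n≡0⇒n≡0 s s+t≡0))))

  mutual
    room⇒pole≤ : ∀ k n E → Room k n (suc E) → Pole≤ E (F k n)
    room⇒pole≤ zero    zero    E _ = pole≤-1ℚ
    room⇒pole≤ zero    (suc n) E _ = pole≤-0ℚ
    room⇒pole≤ (suc k) n       E (s , room , tight) = pole≤-sumFrom1 n _ λ where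
      (suc j) _ 1+j≤n → pole≤-term k n E j s 1+j≤n room
        (λ s≡0 1+j≤p → ≤-<-trans (+-monoˡ-≤ (k * p) 1+j≤p) (tight s≡0))

    pole≤-term : ∀ k n E j s → suc j ≤ n → n + s ≤ suc E * q + suc k →
                 (s ≡ 0 → suc j ≤ p → suc j + k * p < n) → Pole≤ E (recip j ℚ.* F k (n ∸ suc j))
    pole≤-term k n E j s 1+j≤n room tight with recip-pole j
    ... | e , t , pole-e , bound , t≡0⇒ with e ≤? E
    ...   | no e≰E = subst (Pole≤ E) (sym term≡0) pole≤-0ℚ
      where
      room′ : n ∸ suc j + (s + t) ≤ k
      room′ = +-cancelʳ-≤ (e * q) _ _ (begin
        n ∸ suc j + (s + t) + e * q  ≤⟨ remainder-room k E e t 1+j≤n room bound ⟩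
        suc E * q + k                ≤⟨ +-monoˡ-≤ k (*-monoˡ-≤ q (≰⇒> e≰E)) ⟩
        e * q + k                    ≡⟨ +-comm (e * q) k ⟩
        k + e * q                    ∎)
        where open ≤-Reasoning
      term≡0 : recip j ℚ.* F k (n ∸ suc j) ≡ 0ℚ
      term≡0 = trans (cong (recip j ℚ.*_) (room⇒F≡0 (s + t , room′ , remainder-tight k tight t≡0⇒)))
                     (ℚP.*-zeroʳ (recip j))
    ...   | yes e≤E with m≤n⇒∃[o]m+o≡n e≤E
    ...     | d , refl =
      pole≤-* pole-e (room⇒pole≤ k (n ∸ suc j) d (s + t , room′ , remainder-tight k tight t≡0⇒))
      where
      shift : ∀ k e d q → suc (e + d) * q + k ≡ suc d * q + k + e * q
      shift = solve-∀
      room′ : n ∸ suc j + (s + t) ≤ suc d * q + k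
      room′ = +-cancelʳ-≤ (e * q) _ _ (subst (n ∸ suc j + (s + t) + e * q ≤_) (shift k e d q)
        (remainder-room k (e + d) e t 1+j≤n room bound))

  pole≡-F : ∀ k → Pole≡ k (F k (k * p))
  pole≡-F zero    = pole≡-1ℚ
  pole≡-F (suc k) = pole≡-sumFrom1 (p + k * p) _ p (s≤s z≤n) (m≤m+n p (k * p)) diagonal offDiagonal
    where
    diagonal : Pole≡ (suc k) (recip q ℚ.* F k (p + k * p ∸ p))
    diagonal = subst (λ n → Pole≡ (suc k) (recip q ℚ.* F k n)) (sym (m+n∸m≡n p (k * p)))
                     (pole≡-* pole≡-recip (pole≡-F k))
    total : ∀ r k → suc (suc r) + k * suc (suc r) + 0 ≡ suc k * suc r + suc k
    total = solve-∀
    offDiagonal : ∀ i → 1 ≤ i → i ≤ p + k * p → i ≢ p → Pole≤ k (recip (i ∸ 1) ℚ.* F k (p + k * p ∸ i))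
    offDiagonal (suc j) _ 1+j≤n 1+j≢p = pole≤-term k (p + k * p) k j 0 1+j≤n (≤-reflexive (total r k))
      (λ _ 1+j≤p → +-monoˡ-< (k * p) (≤∧≢⇒< 1+j≤p 1+j≢p))

  prime-power-divisor : ∀ e {m n} → ¬ p ∣ m → p ^ e ∣ m * n → p ^ e ∣ n
  prime-power-divisor zero    {m} {n} _   _        = 1∣ n
  prime-power-divisor (suc e) {m} {n} p∤m p^e∣mn
    with euclidsLemma m n p-prime (∣-trans (m∣m*n (p ^ e)) p^e∣mn)
  ... | inj₁ p∣m = ⊥-elim (p∤m p∣m)
  ... | inj₂ (divides c refl) =
    subst (_∣ c * p) (*-comm (p ^ e) p) (*-monoˡ-∣ p (prime-power-divisor e p∤m (*-cancelʳ-∣ p p^e*p∣mc*p)))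
    where
    p^e*p∣mc*p : p ^ e * p ∣ m * c * p
    p^e*p∣mc*p = subst₂ _∣_ (*-comm p (p ^ e)) (sym (*-assoc m c p)) p^e∣mn

  reduced-valuation : ∀ {n d a b e} → Coprime n d → ¬ p ∣ a → ¬ p ∣ b →
                      n * (b * p ^ suc e) ≡ a * d → HasValℕ p n 0 × HasValℕ p d (suc e)
  reduced-valuation {n} {d} {a} {b} {e} coprime p∤a p∤b nbp≡ad =
    (1∣ n , p∤n ∘ subst (_∣ n) (*-identityʳ p)) , (p^e∣d , p^[1+e]∤d)
    where
    p^e∣d : p ^ suc e ∣ d
    p^e∣d = prime-power-divisor (suc e) p∤a (subst (p ^ suc e ∣_) nbp≡ad (∣n⇒∣m*n n (n∣m*n b)))
    p∤n : ¬ p ∣ n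
    p∤n p∣n with coprime (p∣n , ∣-trans (m∣m*n (p ^ e)) p^e∣d)
    ... | ()
    p^[1+e]∤d : ¬ p ^ suc (suc e) ∣ d
    p^[1+e]∤d p^[1+e]∣d = p∤* p∤n p∤b (*-cancelʳ-∣ (p ^ suc e) {{m^n≢0 p (suc e)}}
      (subst (p * p ^ suc e ∣_) (trans (sym nbp≡ad) (sym (*-assoc n b _))) (∣n⇒∣m*n a p^[1+e]∣d)))

  pole≡⇒HasValℚ : ∀ {e x} → Pole≡ (suc e) x → HasValℚ p x (- (+ suc e))
  pole≡⇒HasValℚ {e} {x@(mkℚ n d-1 coprime)} (pole≡ a b p∤a p∤b x≐) =
    x≢0 , 0 , suc e , proj₁ valuations , proj₂ valuations , ℤP.+-identityˡ _
    where
    cross : ℤ.∣ n ∣ * (b * p ^ suc e) ≡ a * suc d-1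
    cross = ≐⇒∣↥∣*≡*↧ₙ x≐
    valuations : HasValℕ p ℤ.∣ n ∣ 0 × HasValℕ p (suc d-1) (suc e)
    valuations = reduced-valuation {e = e} (recompute coprime) p∤a p∤b cross
    x≢0 : x ≢ 0ℚ
    x≢0 x≡0 = p∤a (subst (p ∣_) (sym a≡0) (p ∣0))
      where
      a≡0 : a ≡ 0
      a≡0 = m*n≡0⇒m≡0 a (suc d-1) (trans (sym cross) (cong (λ n → ℤ.∣ ↥ n ∣ * (b * p ^ suc e)) x≡0))

lemma3 : (k p : ℕ) → Prime p →
    HasValℚ p (F (suc k) (suc k * p)) (- (+ (suc k)))
lemma3 k 0             ()
lemma3 k 1             ()
lemma3 k (suc (suc r)) p-prime = pole≡⇒HasValℚ r p-prime (pole≡-F r p-prime (suc k))
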